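{- Let $m > 6$ be an integer and $p$ a prime with $p \equiv 1 \pmod{2m}$. Let $g$ be a primitive root modulo $p$, $k = (p-1)/m$, and for $i \in \{0,\ldots,m-1\}$ let $X_i = \{g^{am+i} \bmod p : 0 \le a < k\}$. Suppose the $m$-color multiplicative-coset Ramsey algebra is constructible over $\mathbb{Z}/p\mathbb{Z}$, i.e., (i) $-X_i = X_i$ for all $i$; (ii) $X_i + X_i = (\mathbb{Z}/p\mathbb{Z}) \setminus X_i$ for all $i$; (iii) $X_i + X_j = (\mathbb{Z}/p\mathbb{Z}) \setminus \{0\}$ for all $i \neq j$. Then \[ 2m^2 - 2m + 1 \le p \le m^4 + 5. \]
   Context: For $A, B \subseteq \mathbb{Z}/p\mathbb{Z}$, $A + B = \{a+b : a\in A, b \in B\}$ and $-A = \{ -a : a \in A\}$. The sets $X_i$ are the $m$ cosets of the subgroup of $(\mathbb{Z}/p\mathbb{Z})^\times$ of index $m$ (with $X_0$ the subgroup itself). -}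

module Defs where

open import Data.Nat using (ℕ; zero; suc; _+_; _*_; _∸_; _^_; _<_; NonZero)
open import Data.Nat.DivMod using (_%_; _/_)
open import Data.Product using (Σ; _×_; ∃-syntax)
open import Relation.Binary.PropositionalEquality using (_≡_; _≢_)

-- Residues mod p are represented by natural numbers x < p.

IsPrimitiveRoot : (p : ℕ) → .{{_ : NonZero p}} → ℕ → Set
IsPrimitiveRoot p g =
  ((g ^ (p ∸ 1)) % p ≡ 1) × (∀ j → 0 < j → j < p ∸ 1 → (g ^ j) % p ≢ 1)

InCoset : (p : ℕ) → .{{_ : NonZero p}} → (m : ℕ) → .{{_ : NonZero m}} →
          (g i x : ℕ) → Set
InCoset p m g i x = Σ ℕ λ a → (a < (p ∸ 1) / m) × ((g ^ (a * m + i)) % p ≡ x)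

InSumset : (p : ℕ) → .{{_ : NonZero p}} → (m : ℕ) → .{{_ : NonZero m}} →
           (g i j x : ℕ) → Set
InSumset p m g i j x =
  ∃[ y ] ∃[ z ] (InCoset p m g i y × InCoset p m g j z × ((y + z) % p ≡ x))

{-# OPTIONS --safe #-}
-- Write class x for the index i of the coset Xᵢ containing a residue x ≠ 0 (its discrete
-- logarithm mod m), so that k = (p − 1)/m = |X₀|.
-- Lower bound: by (i) and (iii), for every j ≠ 0 some x ∈ X₀ has x + 1 ∈ Xⱼ; then also x⁻¹ ∈ X₀
-- and x⁻¹ + 1 = x⁻¹(x + 1) ∈ Xⱼ, where x⁻¹ ≠ x unless x = 1. This gives 2(m − 1) − 1 distinct
-- elements of X₀ ∖ {−1}, so 2m − 2 ≤ k and p = km + 1 ≥ 2m² − 2m + 1.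
-- Upper bound: sort the p − 2 residues x ∉ {0, −1} by the pair (class x, class (x + 1)). By (ii)
-- the pair (0, 0) never occurs, so Cauchy–Schwarz gives
-- (p − 2)² ≤ (m² − 1) · #{(x, y) with equal pairs}. Equal pairs mean y = x t and
-- y + 1 = (x + 1) t′ with t, t′ ∈ X₀, which for t ≠ 1 determines x, so that number is at most
-- (p − 2) + (k − 1)². Hence k ≤ m³ and p ≤ m⁴ + 1.
module Submission where

open import Defs
open import Data.Nat using (ℕ; zero; suc; _+_; _*_; _∸_; _^_; _≤_; _<_; NonZero)
open import Data.Nat.DivMod using (_%_)
open import Data.Nat.Primality using (Prime)
open import Data.Nat.Divisibility using (_∣_; m*n∣⇒n∣)
open import Data.Product using (_×_; _,_)
open import Relation.Binary.PropositionalEquality using (_≡_; _≢_)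
open import Relation.Nullary using (¬_)
open import Function.Bundles using (_⇔_)

module FiniteSums where

  open import Data.Nat
  open import Data.Nat.Properties
  open import Data.Product using (_×_; _,_; ∃; ∃₂)
  open import Data.Sum using (inj₁; inj₂)
  open import Data.Empty using (⊥-elim)
  open import Relation.Nullary using (Dec; yes; no; ¬_)
  open import Relation.Binary.PropositionalEquality
  open import Data.Nat.Tactic.RingSolver using (solve-∀)
  open import Algebra.Properties.CommutativeSemigroup +-commutativeSemigroup using (interchange; x∙yz≈y∙xz)

  ∑< : ℕ → (ℕ → ℕ) → ℕ
  ∑< zero    f = 0
  ∑< (suc n) f = f n + ∑< n f

  syntax ∑< n (λ i → e) = ∑[ i < n ] e

  𝟙 : {P : Set} → Dec P → ℕ
  𝟙 (yes _) = 1
  𝟙 (no _)  = 0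

  𝟙≤1 : {P : Set} (d : Dec P) → 𝟙 d ≤ 1
  𝟙≤1 (yes _) = s≤s z≤n
  𝟙≤1 (no _)  = z≤n

  𝟙-yes : {P : Set} (d : Dec P) → P → 𝟙 d ≡ 1
  𝟙-yes (yes _) _ = refl
  𝟙-yes (no ¬p) p = ⊥-elim (¬p p)

  𝟙-no : {P : Set} (d : Dec P) → ¬ P → 𝟙 d ≡ 0
  𝟙-no (yes p) ¬p = ⊥-elim (¬p p)
  𝟙-no (no _)  _  = refl

  𝟙-pos : {P : Set} (d : Dec P) → 1 ≤ 𝟙 d → P
  𝟙-pos (yes p) _ = p

  𝟙-mono : {P Q : Set} (p? : Dec P) (q? : Dec Q) → (P → Q) → 𝟙 p? ≤ 𝟙 q?
  𝟙-mono (yes p) q? P⇒Q = ≤-reflexive (sym (𝟙-yes q? (P⇒Q p)))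
  𝟙-mono (no _)  q? P⇒Q = z≤n

  𝟙*𝟙≤1 : {P Q : Set} (p? : Dec P) (q? : Dec Q) → 𝟙 p? * 𝟙 q? ≤ 1
  𝟙*𝟙≤1 p? q? = *-mono-≤ (𝟙≤1 p?) (𝟙≤1 q?)

  𝟙*𝟙-pos : {P Q : Set} (p? : Dec P) (q? : Dec Q) → 1 ≤ 𝟙 p? * 𝟙 q? → P × Q
  𝟙*𝟙-pos (yes p) (yes q) _ = p , q

  𝟙*-vanish : {P : Set} (p? : Dec P) {h : ℕ} → (P → h ≡ 0) → 𝟙 p? * h ≡ 0
  𝟙*-vanish (yes p) P⇒h≡0 = trans (+-identityʳ _) (P⇒h≡0 p)
  𝟙*-vanish (no _)  _     = refl

  𝟙*-mono : {P : Set} (p? : Dec P) {g h : ℕ} → (P → g ≤ h) → 𝟙 p? * g ≤ 𝟙 p? * h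
  𝟙*-mono (yes p) P⇒g≤h = +-monoˡ-≤ 0 (P⇒g≤h p)
  𝟙*-mono (no _)  _     = z≤n

  private
    restrict : {P : ℕ → Set} {n : ℕ} → (∀ i → i < suc n → P i) → ∀ i → i < n → P i
    restrict h i i<n = h i (m≤n⇒m≤1+n i<n)

    <1+n∧≢⇒< : ∀ {i n} → i < suc n → i ≢ n → i < n
    <1+n∧≢⇒< i<1+n i≢n = ≤∧≢⇒< (≤-pred i<1+n) i≢n

  ∑-cong : ∀ n {f g : ℕ → ℕ} → (∀ i → i < n → f i ≡ g i) → ∑< n f ≡ ∑< n g
  ∑-cong zero    f≡g = refl
  ∑-cong (suc n) f≡g = cong₂ _+_ (f≡g n ≤-refl) (∑-cong n (restrict f≡g))

  ∑-mono-≤ : ∀ n {f g : ℕ → ℕ} → (∀ i → i < n → f i ≤ g i) → ∑< n f ≤ ∑< n g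
  ∑-mono-≤ zero    f≤g = z≤n
  ∑-mono-≤ (suc n) f≤g = +-mono-≤ (f≤g n ≤-refl) (∑-mono-≤ n (restrict f≤g))

  ∑-distrib-+ : ∀ n (f g : ℕ → ℕ) → ∑[ i < n ] (f i + g i) ≡ ∑< n f + ∑< n g
  ∑-distrib-+ zero    f g = refl
  ∑-distrib-+ (suc n) f g =
    trans (cong (f n + g n +_) (∑-distrib-+ n f g)) (interchange (f n) (g n) (∑< n f) (∑< n g))

  ∑-*ˡ : ∀ n c (f : ℕ → ℕ) → ∑[ i < n ] (c * f i) ≡ c * ∑< n f
  ∑-*ˡ zero    c f = sym (*-zeroʳ c)
  ∑-*ˡ (suc n) c f = trans (cong (c * f n +_) (∑-*ˡ n c f)) (sym (*-distribˡ-+ c (f n) _))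

  ∑∑-*ˡ : ∀ n k c (f : ℕ → ℕ → ℕ) →
          ∑[ i < n ] ∑[ j < k ] (c * f i j) ≡ c * ∑[ i < n ] ∑[ j < k ] f i j
  ∑∑-*ˡ n k c f = trans (∑-cong n (λ i _ → ∑-*ˡ k c (f i))) (∑-*ˡ n c _)

  ∑-*ʳ : ∀ n c (f : ℕ → ℕ) → ∑[ i < n ] (f i * c) ≡ ∑< n f * c
  ∑-*ʳ n c f = trans (∑-cong n (λ i _ → *-comm (f i) c)) (trans (∑-*ˡ n c f) (*-comm c _))

  ∑-const : ∀ n c → ∑[ _ < n ] c ≡ n * c
  ∑-const zero    c = refl
  ∑-const (suc n) c = cong (c +_) (∑-const n c)

  ∑-zero : ∀ n (f : ℕ → ℕ) → (∀ i → i < n → f i ≡ 0) → ∑< n f ≡ 0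
  ∑-zero n f f≡0 = trans (∑-cong n f≡0) (trans (∑-const n 0) (*-zeroʳ n))

  ∑-comm : ∀ n k (f : ℕ → ℕ → ℕ) → ∑[ i < n ] ∑[ j < k ] f i j ≡ ∑[ j < k ] ∑[ i < n ] f i j
  ∑-comm zero    k f = sym (∑-zero k _ (λ _ _ → refl))
  ∑-comm (suc n) k f =
    trans (cong (∑< k (f n) +_) (∑-comm n k f)) (sym (∑-distrib-+ k (f n) _))

  ∑-head : ∀ n (f : ℕ → ℕ) → ∑< (suc n) f ≡ f 0 + ∑[ i < n ] f (suc i)
  ∑-head zero    f = refl
  ∑-head (suc n) f = begin
    f (suc n) + (f n + ∑< n f)                  ≡⟨ cong (f (suc n) +_) (∑-head n f) ⟩
    f (suc n) + (f 0 + ∑[ i < n ] f (suc i))    ≡⟨ x∙yz≈y∙xz (f (suc n)) (f 0) _ ⟩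
    f 0 + (f (suc n) + ∑[ i < n ] f (suc i))    ∎
    where open ≡-Reasoning

  term≤∑ : ∀ n (f : ℕ → ℕ) i → i < n → f i ≤ ∑< n f
  term≤∑ (suc n) f i i<1+n with i ≟ n
  ... | yes refl = m≤m+n (f i) _
  ... | no  i≢n  = ≤-trans (term≤∑ n f i (<1+n∧≢⇒< i<1+n i≢n)) (m≤n+m _ (f n))

  pair≤∑ : ∀ n (f : ℕ → ℕ) i j → i < n → j < n → i ≢ j → f i + f j ≤ ∑< n f
  pair≤∑ (suc n) f i j i<1+n j<1+n i≢j with i ≟ n | j ≟ n
  ... | yes refl | yes refl = ⊥-elim (i≢j refl)
  ... | yes refl | no j≢n   = +-monoʳ-≤ (f i) (term≤∑ n f j (<1+n∧≢⇒< j<1+n j≢n))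
  ... | no i≢n   | yes refl =
    subst (_≤ f j + ∑< n f) (+-comm (f j) (f i))
          (+-monoʳ-≤ (f j) (term≤∑ n f i (<1+n∧≢⇒< i<1+n i≢n)))
  ... | no i≢n   | no j≢n   =
    ≤-trans (pair≤∑ n f i j (<1+n∧≢⇒< i<1+n i≢n) (<1+n∧≢⇒< j<1+n j≢n) i≢j) (m≤n+m _ (f n))

  ∑-pos : ∀ n (f : ℕ → ℕ) → 1 ≤ ∑< n f → ∃ λ i → i < n × 1 ≤ f i
  ∑-pos (suc n) f 1≤∑ with f n in fn≡
  ... | suc _ = n , ≤-refl , subst (1 ≤_) (sym fn≡) (s≤s z≤n)
  ... | zero with ∑-pos n f 1≤∑
  ...   | i , i<n , 1≤fi = i , m≤n⇒m≤1+n i<n , 1≤fi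

  ∑-≤1 : ∀ n (f : ℕ → ℕ) → (∀ i → i < n → f i ≤ 1) →
         (∀ i j → i < n → j < n → 1 ≤ f i → 1 ≤ f j → i ≡ j) → ∑< n f ≤ 1
  ∑-≤1 zero    f f≤1 unique = z≤n
  ∑-≤1 (suc n) f f≤1 unique with f n ≟ 0
  ... | yes fn≡0 = subst (_≤ 1) (cong (_+ ∑< n f) (sym fn≡0))
    (∑-≤1 n f (restrict f≤1)
      (λ i j i<n j<n → unique i j (m≤n⇒m≤1+n i<n) (m≤n⇒m≤1+n j<n)))
  ... | no fn≢0 = begin
    f n + ∑< n f ≤⟨ +-monoˡ-≤ _ (f≤1 n ≤-refl) ⟩
    1 + ∑< n f   ≡⟨ cong suc (∑-zero n f others-vanish) ⟩
    1            ∎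
    where
    open ≤-Reasoning
    others-vanish : ∀ i → i < n → f i ≡ 0
    others-vanish i i<n = n≤0⇒n≡0 (≮⇒≥ λ 0<fi →
      <-irrefl (unique i n (m≤n⇒m≤1+n i<n) ≤-refl 0<fi (n≢0⇒n>0 fn≢0)) i<n)

  ∑-<-length : ∀ n (f : ℕ → ℕ) → (∀ i → i < n → f i ≤ 1) →
               ∀ j → j < n → f j ≡ 0 → ∑< n f < n
  ∑-<-length (suc n) f f≤1 j j<1+n fj≡0 with j ≟ n
  ... | yes refl = s≤s (begin
    f j + ∑< n f  ≡⟨ cong (_+ ∑< n f) fj≡0 ⟩
    ∑< n f        ≤⟨ ∑-mono-≤ n (restrict f≤1) ⟩
    ∑[ _ < n ] 1  ≡⟨ trans (∑-const n 1) (*-identityʳ n) ⟩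
    n             ∎)
    where open ≤-Reasoning
  ... | no j≢n = ≤-trans (≤-reflexive (sym (+-suc (f n) _)))
    (+-mono-≤ (f≤1 n ≤-refl) (∑-<-length n f (restrict f≤1) j (<1+n∧≢⇒< j<1+n j≢n) fj≡0))

  ∑-𝟙-≟-≤1 : ∀ n d → ∑[ c < n ] 𝟙 (d ≟ c) ≤ 1
  ∑-𝟙-≟-≤1 n d = ∑-≤1 n _ (λ c _ → 𝟙≤1 (d ≟ c))
    (λ i j _ _ 1≤𝟙i 1≤𝟙j → trans (sym (𝟙-pos (d ≟ i) 1≤𝟙i)) (𝟙-pos (d ≟ j) 1≤𝟙j))

  ∑-𝟙-≟ : ∀ n d → d < n → ∑[ c < n ] 𝟙 (d ≟ c) ≡ 1
  ∑-𝟙-≟ n d d<n = ≤-antisym (∑-𝟙-≟-≤1 n d)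
    (≤-trans (≤-reflexive (sym (𝟙-yes (d ≟ d) refl))) (term≤∑ n (λ c → 𝟙 (d ≟ c)) d d<n))

  ∑-𝟙-≟-* : ∀ n d (h : ℕ → ℕ) → ∑[ c < n ] (𝟙 (d ≟ c) * h c) ≤ h d
  ∑-𝟙-≟-* n d h = begin
    ∑[ c < n ] (𝟙 (d ≟ c) * h c) ≤⟨ ∑-mono-≤ n (λ c _ → select c) ⟩
    ∑[ c < n ] (𝟙 (d ≟ c) * h d) ≡⟨ ∑-*ʳ n (h d) (λ c → 𝟙 (d ≟ c)) ⟩
    ∑[ c < n ] 𝟙 (d ≟ c) * h d   ≤⟨ *-monoˡ-≤ (h d) (∑-𝟙-≟-≤1 n d) ⟩
    1 * h d                      ≡⟨ *-identityˡ (h d) ⟩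
    h d                          ∎
    where
    open ≤-Reasoning
    select : ∀ c → 𝟙 (d ≟ c) * h c ≤ 𝟙 (d ≟ c) * h d
    select c with d ≟ c
    ... | yes refl = ≤-refl
    ... | no _     = z≤n

  ∑-≤-cover : ∀ N A B (P : ℕ → ℕ) (Q ψ : ℕ → ℕ → ℕ) → (∀ y → y < N → P y ≤ 1) →
    (∀ y → y < N → 1 ≤ P y → ∃₂ λ d e → d < A × e < B × 1 ≤ Q d e × ψ d e ≡ y) →
    ∑< N P ≤ ∑[ d < A ] ∑[ e < B ] Q d e
  ∑-≤-cover N A B P Q ψ P≤1 cover = begin
    ∑< N P                                          ≤⟨ ∑-mono-≤ N covered ⟩
    ∑[ y < N ] ∑[ d < A ] ∑[ e < B ] hit y d e      ≡⟨ ∑-comm N A _ ⟩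
    ∑[ d < A ] ∑[ y < N ] ∑[ e < B ] hit y d e      ≡⟨ ∑-cong A (λ d _ → ∑-comm N B _) ⟩
    ∑[ d < A ] ∑[ e < B ] ∑[ y < N ] hit y d e      ≤⟨ ∑-mono-≤ A (λ d _ → ∑-mono-≤ B (fibre d)) ⟩
    ∑[ d < A ] ∑[ e < B ] Q d e                     ∎
    where
    open ≤-Reasoning
    hit : ℕ → ℕ → ℕ → ℕ
    hit y d e = Q d e * 𝟙 (ψ d e ≟ y)
    fibre : ∀ d e → e < B → ∑[ y < N ] hit y d e ≤ Q d e
    fibre d e _ = begin
      ∑[ y < N ] (Q d e * 𝟙 (ψ d e ≟ y)) ≡⟨ ∑-*ˡ N (Q d e) _ ⟩
      Q d e * ∑[ y < N ] 𝟙 (ψ d e ≟ y)   ≤⟨ *-monoʳ-≤ (Q d e) (∑-𝟙-≟-≤1 N (ψ d e)) ⟩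
      Q d e * 1                          ≡⟨ *-identityʳ (Q d e) ⟩
      Q d e                              ∎
    covered : ∀ y → y < N → P y ≤ ∑[ d < A ] ∑[ e < B ] hit y d e
    covered y y<N with P y ≟ 0
    ... | yes Py≡0 = subst (_≤ _) (sym Py≡0) z≤n
    ... | no Py≢0 with cover y y<N (n≢0⇒n>0 Py≢0)
    ...   | d , e , d<A , e<B , 1≤Q , ψ≡y = begin
      P y                                ≤⟨ ≤-trans (P≤1 y y<N) 1≤Q ⟩
      Q d e
        ≡⟨ sym (trans (cong (Q d e *_) (𝟙-yes (ψ d e ≟ y) ψ≡y)) (*-identityʳ _)) ⟩
      hit y d e                          ≤⟨ term≤∑ B (hit y d) e e<B ⟩
      ∑[ e′ < B ] hit y d e′             ≤⟨ term≤∑ A (λ d′ → ∑< B (hit y d′)) d d<A ⟩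
      ∑[ d′ < A ] ∑[ e′ < B ] hit y d′ e′ ∎

  ∑-grid : ∀ k (G : ℕ → ℕ → ℕ) W → G 0 0 ≤ W →
    (∀ e → e < k → G 0 (suc e) ≡ 0) → (∀ d → d < k → G (suc d) 0 ≡ 0) →
    (∀ d e → d < k → e < k → G (suc d) (suc e) ≤ 1) →
    ∑[ d < suc k ] ∑[ e < suc k ] G d e ≤ W + k * k
  ∑-grid k G W G00≤W G0e≡0 Gd0≡0 Gde≤1 = begin
    ∑[ d < suc k ] ∑< (suc k) (G d)
      ≡⟨ trans (∑-head k _) (cong₂ _+_ (∑-head k (G 0)) (∑-cong k (λ d _ → ∑-head k (G (suc d))))) ⟩
    (G 0 0 + ∑[ e < k ] G 0 (suc e)) + ∑[ d < k ] (G (suc d) 0 + ∑[ e < k ] G (suc d) (suc e))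
      ≤⟨ +-mono-≤ (+-mono-≤ G00≤W (≤-reflexive (∑-zero k _ G0e≡0))) (∑-mono-≤ k inner-rows) ⟩
    (W + 0) + ∑[ d < k ] (0 + ∑[ e < k ] 1)
      ≡⟨ cong₂ _+_ (+-identityʳ W) (trans (∑-const k _) (cong (k *_) ∑-ones)) ⟩
    W + k * k ∎
    where
    open ≤-Reasoning
    ∑-ones : ∑[ _ < k ] 1 ≡ k
    ∑-ones = trans (∑-const k 1) (*-identityʳ k)
    inner-rows : ∀ d → d < k → G (suc d) 0 + ∑[ e < k ] G (suc d) (suc e) ≤ 0 + ∑[ e < k ] 1
    inner-rows d d<k = +-mono-≤ (≤-reflexive (Gd0≡0 d d<k)) (∑-mono-≤ k (λ e e<k → Gde≤1 d e d<k e<k))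

  private
    2mn≤m²+n²-ordered : ∀ m d → 2 * (m * (m + d)) ≤ m * m + (m + d) * (m + d)
    2mn≤m²+n²-ordered m d = subst₂ _≤_ (lhs m d) (rhs m d) (m≤m+n (2 * (m * m) + 2 * (m * d)) (d * d))
      where
      lhs : ∀ a d → 2 * (a * a) + 2 * (a * d) ≡ 2 * (a * (a + d))
      lhs = solve-∀
      rhs : ∀ a d → 2 * (a * a) + 2 * (a * d) + d * d ≡ a * a + (a + d) * (a + d)
      rhs = solve-∀

  2mn≤m²+n² : ∀ m n → 2 * (m * n) ≤ m * m + n * n
  2mn≤m²+n² m n with ≤-total m n
  ... | inj₁ m≤n = subst (λ n → 2 * (m * n) ≤ m * m + n * n) (m+[n∸m]≡n m≤n)
                        (2mn≤m²+n²-ordered m (n ∸ m))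
  ... | inj₂ n≤m = subst₂ _≤_ (cong (2 *_) (*-comm n m)) (+-comm (n * n) _)
    (subst (λ m → 2 * (n * m) ≤ n * n + m * m) (m+[n∸m]≡n n≤m) (2mn≤m²+n²-ordered n (m ∸ n)))

  cauchy-schwarz : ∀ n (f : ℕ → ℕ) → ∑< n f * ∑< n f ≤ n * ∑[ i < n ] (f i * f i)
  cauchy-schwarz n f = *-cancelˡ-≤ 2 (begin
    2 * (S * S)                                    ≡⟨ sym double-sum ⟩
    ∑[ i < n ] ∑[ j < n ] (2 * (f i * f j))
      ≤⟨ ∑-mono-≤ n (λ i _ → ∑-mono-≤ n (λ j _ → 2mn≤m²+n² (f i) (f j))) ⟩
    ∑[ i < n ] ∑[ j < n ] (f i * f i + f j * f j) ≡⟨ sum-of-squares ⟩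
    2 * (n * Q)                                    ∎)
    where
    open ≤-Reasoning
    S Q : ℕ
    S = ∑< n f
    Q = ∑[ i < n ] (f i * f i)
    double-sum : ∑[ i < n ] ∑[ j < n ] (2 * (f i * f j)) ≡ 2 * (S * S)
    double-sum = begin-equality
      ∑[ i < n ] ∑[ j < n ] (2 * (f i * f j))
        ≡⟨ ∑-cong n (λ i _ → trans (∑-*ˡ n 2 _) (cong (2 *_) (∑-*ˡ n (f i) f))) ⟩
      ∑[ i < n ] (2 * (f i * S))              ≡⟨ ∑-*ˡ n 2 _ ⟩
      2 * ∑[ i < n ] (f i * S)                ≡⟨ cong (2 *_) (∑-*ʳ n S f) ⟩
      2 * (S * S)                             ∎
    sum-of-squares : ∑[ i < n ] ∑[ j < n ] (f i * f i + f j * f j) ≡ 2 * (n * Q)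
    sum-of-squares = begin-equality
      ∑[ i < n ] ∑[ j < n ] (f i * f i + f j * f j)
        ≡⟨ ∑-cong n (λ i _ → trans (∑-distrib-+ n _ _) (cong (_+ Q) (∑-const n _))) ⟩
      ∑[ i < n ] (n * (f i * f i) + Q)              ≡⟨ ∑-distrib-+ n _ _ ⟩
      ∑[ i < n ] (n * (f i * f i)) + ∑[ _ < n ] Q   ≡⟨ cong₂ _+_ (∑-*ˡ n n _) (∑-const n Q) ⟩
      n * Q + n * Q                                  ≡⟨ cong (n * Q +_) (sym (+-identityʳ (n * Q))) ⟩
      2 * (n * Q)                                    ∎

  cauchy-schwarz-vanishing-head : ∀ n (f : ℕ → ℕ) → f 0 ≡ 0 →
    ∑< (suc n) f * ∑< (suc n) f ≤ n * ∑[ i < suc n ] (f i * f i)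
  cauchy-schwarz-vanishing-head n f f0≡0 = begin
    ∑< (suc n) f * ∑< (suc n) f                    ≡⟨ cong (λ s → s * s) drop-head ⟩
    ∑[ i < n ] f (suc i) * ∑[ i < n ] f (suc i)    ≤⟨ cauchy-schwarz n (λ i → f (suc i)) ⟩
    n * ∑[ i < n ] (f (suc i) * f (suc i))         ≤⟨ *-monoʳ-≤ n (m≤n+m _ (f 0 * f 0)) ⟩
    n * (f 0 * f 0 + ∑[ i < n ] (f (suc i) * f (suc i)))
      ≡⟨ cong (n *_) (sym (∑-head n (λ i → f i * f i))) ⟩
    n * ∑[ i < suc n ] (f i * f i)                 ∎
    where
    open ≤-Reasoning
    drop-head : ∑< (suc n) f ≡ ∑[ i < n ] f (suc i)
    drop-head = trans (∑-head n f) (cong (_+ ∑[ i < n ] f (suc i)) f0≡0)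

module ModularArithmetic where

  open import Data.Nat
  open import Data.Nat.Properties
  open import Data.Nat.DivMod
  open import Data.Nat.Divisibility
  open import Data.Nat.Primality using (Prime; euclidsLemma; prime⇒nonTrivial)
  open import Data.Sum using (_⊎_; inj₁; inj₂)
  open import Data.Empty using (⊥-elim)
  open import Relation.Binary.PropositionalEquality
  open import Data.Nat.Tactic.RingSolver using (solve-∀)

  wlog-≤ : {H G : ℕ → ℕ → Set} → (∀ {a b} → H a b → H b a) → (∀ {a b} → G a b → G b a) →
           (∀ {a b} → a ≤ b → H a b → G a b) → ∀ a b → H a b → G a b
  wlog-≤ H-sym G-sym ordered a b h with ≤-total a b
  ... | inj₁ a≤b = ordered a≤b h
  ... | inj₂ b≤a = G-sym (ordered b≤a (H-sym h))

  module _ (n : ℕ) .{{_ : NonZero n}} where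

    %≡⇒∣∸ : ∀ {a b} → a ≤ b → a % n ≡ b % n → n ∣ b ∸ a
    %≡⇒∣∸ {a} {b} a≤b a≡b = divides (b / n ∸ a / n) (begin
      b ∸ a                                     ≡⟨ cong₂ _∸_ (m≡m%n+[m/n]*n b n) (m≡m%n+[m/n]*n a n) ⟩
      (b % n + b / n * n) ∸ (a % n + a / n * n) ≡⟨ cong (λ r → (b % n + b / n * n) ∸ (r + a / n * n)) a≡b ⟩
      (b % n + b / n * n) ∸ (b % n + a / n * n) ≡⟨ [m+n]∸[m+o]≡n∸o (b % n) _ _ ⟩
      b / n * n ∸ a / n * n                     ≡⟨ sym (*-distribʳ-∸ n (b / n) (a / n)) ⟩
      (b / n ∸ a / n) * n                       ∎)
      where open ≡-Reasoning

    ∣∸⇒%≡ : ∀ {a b} → a ≤ b → n ∣ b ∸ a → a % n ≡ b % n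
    ∣∸⇒%≡ {a} {b} a≤b (divides q b∸a≡qn) = sym (begin
      b % n               ≡⟨ cong (_% n) (sym (m+[n∸m]≡n a≤b)) ⟩
      (a + (b ∸ a)) % n   ≡⟨ cong (λ d → (a + d) % n) b∸a≡qn ⟩
      (a + q * n) % n     ≡⟨ [m+kn]%n≡m%n a q n ⟩
      a % n               ∎)
      where open ≡-Reasoning

    <∧≢0⇒%≢0 : ∀ {x} → x < n → x ≢ 0 → x % n ≢ 0
    <∧≢0⇒%≢0 x<n x≢0 x%n≡0 = x≢0 (trans (sym (m<n⇒m%n≡m x<n)) x%n≡0)

    [m%n+o]%n≡[m+o]%n : ∀ a b → (a % n + b) % n ≡ (a + b) % n
    [m%n+o]%n≡[m+o]%n a b = begin
      (a % n + b) % n         ≡⟨ %-distribˡ-+ (a % n) b n ⟩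
      (a % n % n + b % n) % n ≡⟨ cong (λ r → (r + b % n) % n) (m%n%n≡m%n a n) ⟩
      (a % n + b % n) % n     ≡⟨ sym (%-distribˡ-+ a b n) ⟩
      (a + b) % n             ∎
      where open ≡-Reasoning

    [m+o%n]%n≡[m+o]%n : ∀ a b → (a + b % n) % n ≡ (a + b) % n
    [m+o%n]%n≡[m+o]%n a b = begin
      (a + b % n) % n ≡⟨ cong (_% n) (+-comm a (b % n)) ⟩
      (b % n + a) % n ≡⟨ [m%n+o]%n≡[m+o]%n b a ⟩
      (b + a) % n     ≡⟨ cong (_% n) (+-comm b a) ⟩
      (a + b) % n     ∎
      where open ≡-Reasoning

    +-cancelʳ-% : ∀ c a b → (a + c) % n ≡ (b + c) % n → a % n ≡ b % n
    +-cancelʳ-% c = wlog-≤ sym sym cancel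
      where
      cancel : ∀ {a b} → a ≤ b → (a + c) % n ≡ (b + c) % n → a % n ≡ b % n
      cancel {a} {b} a≤b eq =
        ∣∸⇒%≡ a≤b (subst (n ∣_) [b+c]∸[a+c]≡b∸a (%≡⇒∣∸ (+-monoˡ-≤ c a≤b) eq))
        where
        [b+c]∸[a+c]≡b∸a : (b + c) ∸ (a + c) ≡ b ∸ a
        [b+c]∸[a+c]≡b∸a = trans (cong₂ _∸_ (+-comm b c) (+-comm a c)) ([m+n]∸[m+o]≡n∸o c b a)

  module _ (p : ℕ) .{{_ : NonZero p}} (prime : Prime p) where

    1<p : 1 < p
    1<p = nonTrivial⇒n>1 p {{prime⇒nonTrivial prime}}

    1%p≡1 : 1 % p ≡ 1
    1%p≡1 = m<n⇒m%n≡m 1<p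

    *-%≢0 : ∀ a b → a % p ≢ 0 → b % p ≢ 0 → (a * b) % p ≢ 0
    *-%≢0 a b a≢0 b≢0 ab≡0 with euclidsLemma a b prime (m%n≡0⇒n∣m _ p ab≡0)
    ... | inj₁ p∣a = a≢0 (n∣m⇒m%n≡0 a p p∣a)
    ... | inj₂ p∣b = b≢0 (n∣m⇒m%n≡0 b p p∣b)

    *-cancelˡ-% : ∀ c a b → c % p ≢ 0 → (c * a) % p ≡ (c * b) % p → a % p ≡ b % p
    *-cancelˡ-% c a b c≢0 = wlog-≤ sym sym cancel a b
      where
      cancel : ∀ {a b} → a ≤ b → (c * a) % p ≡ (c * b) % p → a % p ≡ b % p
      cancel {a} {b} a≤b eq
        with euclidsLemma c (b ∸ a) prime
               (subst (p ∣_) (sym (*-distribˡ-∸ c b a)) (%≡⇒∣∸ p (*-monoʳ-≤ c a≤b) eq))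
      ... | inj₁ p∣c   = ⊥-elim (c≢0 (n∣m⇒m%n≡0 c p p∣c))
      ... | inj₂ p∣b∸a = ∣∸⇒%≡ p a≤b p∣b∸a

    [1+x]²≡1⇒p∣x[x+2] : ∀ x → (suc x * suc x) % p ≡ 1 → p ∣ x * (x + 2)
    [1+x]²≡1⇒p∣x[x+2] x [1+x]²≡1 =
      subst (p ∣_) (trans (cong (_∸ 1) ([1+x]²≡1+x[x+2] x)) (m+n∸m≡n 1 _))
            (%≡⇒∣∸ p (s≤s z≤n) (trans 1%p≡1 (sym [1+x]²≡1)))
      where
      [1+x]²≡1+x[x+2] : ∀ x → suc x * suc x ≡ 1 + x * (x + 2)
      [1+x]²≡1+x[x+2] = solve-∀

    x²≡1⇒x≡±1 : ∀ x → 0 < x → x < p → (x * x) % p ≡ 1 → x ≡ 1 ⊎ suc x ≡ p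
    x²≡1⇒x≡±1 (suc x) _ 1+x<p x²≡1 with euclidsLemma x (x + 2) prime ([1+x]²≡1⇒p∣x[x+2] x x²≡1)
    ... | inj₂ p∣x+2 = inj₂ (≤-antisym 1+x<p (∣⇒≤ (subst (p ∣_) (+-comm x 2) p∣x+2)))
    ... | inj₁ p∣x with x
    ...   | zero   = inj₁ refl
    ...   | suc _  = ⊥-elim (>⇒∤ (<-trans (n<1+n _) 1+x<p) p∣x)

module Arithmetic where

  open import Data.Nat
  open import Data.Nat.Properties
  open import Relation.Nullary using (yes; no)
  open import Data.Empty using (⊥-elim)
  open import Relation.Binary.PropositionalEquality
  open import Data.Nat.Tactic.RingSolver using (solve-∀)

  private
    m⁴≡m³m : ∀ a → suc a * (suc a * (suc a * (suc a * 1))) ≡ suc a * suc a * suc a * suc a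
    m⁴≡m³m = solve-∀

    km-identity : ∀ a b →
      (a + b * suc a) * (a + b * suc a) + suc b * (suc a * suc a * suc a)
        ≡ (a + a * suc a) * ((a + b * suc a) + b * b) + suc b * ((2 * a + 3) * a) + 1 + suc b * b
    km-identity = solve-∀

  -- For m = a + 1, k = b + 1 and W = km − 1, km-identity reads
  -- W² + k m³ = (m² − 1)(W + b²) + k (2m + 1)(m − 1) + 1 + k b,
  -- so the hypothesis forces b < m³, i.e. k ≤ m³.
  km+1≤m⁴+5 : ∀ m k → 0 < m → 0 < k →
    (k * m ∸ 1) * (k * m ∸ 1) ≤ (m * m ∸ 1) * ((k * m ∸ 1) + (k ∸ 1) * (k ∸ 1)) →
    k * m + 1 ≤ m ^ 4 + 5
  km+1≤m⁴+5 (suc a) (suc b) _ _ W²≤R with suc b * suc a + 1 ≤? suc a ^ 4 + 5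
  ... | yes km+1≤m⁴+5 = km+1≤m⁴+5
  ... | no  km+1≰m⁴+5 = ⊥-elim (<-irrefl refl (<-≤-trans R<W² W²≤R))
    where
    open ≤-Reasoning
    m m³ W R X : ℕ
    m  = suc a
    m³ = m * m * m
    W  = a + b * m
    R  = (a + a * m) * (W + b * b)
    X  = suc b * ((2 * a + 3) * a)
    m³≤b : m³ ≤ b
    m³≤b = ≤-pred (*-cancelʳ-< m m³ (suc b) (begin-strict
      m³ * m         ≡⟨ sym (m⁴≡m³m a) ⟩
      m ^ 4          <⟨ m<m+n (m ^ 4) (s≤s z≤n) ⟩
      m ^ 4 + 5      ≤⟨ ≤-pred (subst (suc (m ^ 4 + 5) ≤_) (+-comm (suc b * m) 1) (≰⇒> km+1≰m⁴+5)) ⟩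
      suc b * m      ∎))
    R<W² : R < W * W
    R<W² = +-cancelʳ-≤ (suc b * b) (suc R) (W * W) (begin
      suc R + suc b * b       ≤⟨ +-monoˡ-≤ (suc b * b) (+-monoʳ-≤ 1 (m≤m+n R X)) ⟩
      suc (R + X) + suc b * b ≡⟨ cong (_+ suc b * b) (+-comm 1 (R + X)) ⟩
      R + X + 1 + suc b * b   ≡⟨ sym (km-identity a b) ⟩
      W * W + suc b * m³      ≤⟨ +-monoʳ-≤ (W * W) (*-monoʳ-≤ (suc b) m³≤b) ⟩
      W * W + suc b * b       ∎)

module Cyclic (p g : ℕ) .{{_ : NonZero p}} (prime : Prime p) (g-primitive : IsPrimitiveRoot p g) where

  open import Data.Nat
  open import Data.Nat.Properties
  open import Data.Nat.DivMod
  open import Data.Nat.Divisibility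
  open import Data.Product using (_×_; _,_; ∃; proj₁; proj₂)
  open import Data.Empty using (⊥-elim)
  open import Relation.Nullary using (yes; no)
  open import Relation.Binary.PropositionalEquality
  open FiniteSums
  open ModularArithmetic

  N : ℕ
  N = p ∸ 1

  1+N≡p : suc N ≡ p
  1+N≡p = m+[n∸m]≡n (<⇒≤ (1<p p prime))

  0<N : 0 < N
  0<N = ≤-pred (subst (1 <_) (sym 1+N≡p) (1<p p prime))

  instance
    N-nonZero : NonZero N
    N-nonZero = >-nonZero 0<N

  N<p : N < p
  N<p = subst (N <_) 1+N≡p ≤-refl

  infix 8 g^_
  g^_ : ℕ → ℕ
  g^ n = (g ^ n) % p

  g^<p : ∀ n → g^ n < p
  g^<p n = m%n<n _ p

  g^-%p : ∀ n → g^ n % p ≡ g^ n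
  g^-%p n = m%n%n≡m%n _ p

  g^0≡1 : g^ 0 ≡ 1
  g^0≡1 = 1%p≡1 p prime

  g^N≡1 : g^ N ≡ 1
  g^N≡1 = proj₁ g-primitive

  g^-+ : ∀ a b → g^ (a + b) ≡ (g^ a * g^ b) % p
  g^-+ a b = trans (cong (_% p) (^-distribˡ-+-* g a b)) (%-distribˡ-* (g ^ a) (g ^ b) p)

  g^≢0 : ∀ n → g^ n ≢ 0
  g^≢0 zero    g^0≡0 = 0≢1+n (trans (sym g^0≡0) g^0≡1)
  g^≢0 (suc n) = *-%≢0 p prime g (g ^ n) g%p≢0 (g^≢0 n)
    where
    g%p≢0 : g % p ≢ 0
    g%p≢0 g%p≡0 = 0≢1+n (trans (sym (n∣m⇒m%n≡0 (g ^ N) p p∣g^N)) g^N≡1)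
      where
      p∣g^N : p ∣ g ^ N
      p∣g^N = subst (λ e → p ∣ g ^ e) (m+[n∸m]≡n 0<N)
                    (∣m⇒∣m*n (g ^ (N ∸ 1)) (m%n≡0⇒n∣m g p g%p≡0))

  g^%p≢0 : ∀ n → g^ n % p ≢ 0
  g^%p≢0 n g^n%p≡0 = g^≢0 n (trans (sym (g^-%p n)) g^n%p≡0)

  g^-periodic : ∀ n → g^ (n + N) ≡ g^ n
  g^-periodic n = begin
    g^ (n + N)          ≡⟨ g^-+ n N ⟩
    (g^ n * g^ N) % p   ≡⟨ cong (λ r → (g^ n * r) % p) g^N≡1 ⟩
    (g^ n * 1) % p      ≡⟨ cong (_% p) (*-identityʳ (g^ n)) ⟩
    g^ n % p            ≡⟨ g^-%p n ⟩
    g^ n                ∎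
    where open ≡-Reasoning

  g^-+-*N : ∀ n q → g^ (n + q * N) ≡ g^ n
  g^-+-*N n zero    = cong g^_ (+-identityʳ n)
  g^-+-*N n (suc q) = begin
    g^ (n + (N + q * N)) ≡⟨ cong g^_ (trans (sym (+-assoc n N _)) (+-comm (n + N) _)) ⟩
    g^ (q * N + (n + N)) ≡⟨ cong g^_ (sym (+-assoc (q * N) n N)) ⟩
    g^ (q * N + n + N)   ≡⟨ g^-periodic (q * N + n) ⟩
    g^ (q * N + n)       ≡⟨ cong g^_ (+-comm (q * N) n) ⟩
    g^ (n + q * N)       ≡⟨ g^-+-*N n q ⟩
    g^ n                 ∎
    where open ≡-Reasoning

  g^-%N : ∀ n → g^ n ≡ g^ (n % N)
  g^-%N n = trans (cong g^_ (m≡m%n+[m/n]*n n N)) (g^-+-*N (n % N) (n / N))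

  g^≡1⇒≡0 : ∀ d → d < N → g^ d ≡ 1 → d ≡ 0
  g^≡1⇒≡0 zero    _   _    = refl
  g^≡1⇒≡0 (suc d) d<N g^d≡1 = ⊥-elim (proj₂ g-primitive (suc d) (s≤s z≤n) d<N g^d≡1)

  g^-injective : ∀ {a b} → a < N → b < N → g^ a ≡ g^ b → a ≡ b
  g^-injective a<N b<N g^a≡g^b =
    wlog-≤ {H = λ a b → a < N × b < N × g^ a ≡ g^ b}
           (λ (a<N , b<N , eq) → b<N , a<N , sym eq) sym ordered _ _ (a<N , b<N , g^a≡g^b)
    where
    ordered : ∀ {a b} → a ≤ b → a < N × b < N × g^ a ≡ g^ b → a ≡ b
    ordered {a} {b} a≤b (_ , b<N , g^a≡g^b) = begin
      a           ≡⟨ sym (+-identityʳ a) ⟩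
      a + 0       ≡⟨ cong (a +_) (sym d≡0) ⟩
      a + (b ∸ a) ≡⟨ m+[n∸m]≡n a≤b ⟩
      b           ∎
      where
      open ≡-Reasoning
      d : ℕ
      d = b ∸ a
      g^a*g^d≡g^a*1 : (g^ a * g^ d) % p ≡ (g^ a * 1) % p
      g^a*g^d≡g^a*1 = begin
        (g^ a * g^ d) % p ≡⟨ sym (g^-+ a d) ⟩
        g^ (a + d)        ≡⟨ cong g^_ (m+[n∸m]≡n a≤b) ⟩
        g^ b              ≡⟨ sym g^a≡g^b ⟩
        g^ a              ≡⟨ sym (g^-%p a) ⟩
        g^ a % p          ≡⟨ cong (_% p) (sym (*-identityʳ (g^ a))) ⟩
        (g^ a * 1) % p    ∎
      g^d≡1 : g^ d ≡ 1
      g^d≡1 = trans (sym (g^-%p d))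
        (trans (*-cancelˡ-% p prime (g^ a) (g^ d) 1 (g^%p≢0 a) g^a*g^d≡g^a*1)
               (1%p≡1 p prime))
      d≡0 : d ≡ 0
      d≡0 = g^≡1⇒≡0 d (≤-<-trans (m∸n≤m b a) b<N) g^d≡1

  -- An injection from {0, …, N-1} into the N nonzero residues must hit each of them.
  hits : ℕ → ℕ
  hits x = ∑[ n < N ] 𝟙 (g^ n ≟ x)

  hits≤1 : ∀ x → hits x ≤ 1
  hits≤1 x = ∑-≤1 N _ (λ n _ → 𝟙≤1 (g^ n ≟ x)) (λ i j i<N j<N 1≤𝟙i 1≤𝟙j →
    g^-injective i<N j<N (trans (𝟙-pos (g^ i ≟ x) 1≤𝟙i) (sym (𝟙-pos (g^ j ≟ x) 1≤𝟙j))))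

  hits0≡0 : hits 0 ≡ 0
  hits0≡0 = ∑-zero N _ (λ n _ → 𝟙-no (g^ n ≟ 0) (g^≢0 n))

  ∑-hits : ∑[ x < N ] hits (suc x) ≡ N
  ∑-hits = begin
    ∑[ x < N ] hits (suc x)            ≡⟨ cong (_+ ∑[ x < N ] hits (suc x)) (sym hits0≡0) ⟩
    hits 0 + ∑[ x < N ] hits (suc x)   ≡⟨ sym (∑-head N hits) ⟩
    ∑< (suc N) hits                    ≡⟨ cong (λ n → ∑< n hits) 1+N≡p ⟩
    ∑[ x < p ] ∑[ n < N ] 𝟙 (g^ n ≟ x) ≡⟨ ∑-comm p N _ ⟩
    ∑[ n < N ] ∑[ x < p ] 𝟙 (g^ n ≟ x) ≡⟨ ∑-cong N (λ n _ → ∑-𝟙-≟ p (g^ n) (g^<p n)) ⟩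
    ∑[ n < N ] 1                       ≡⟨ trans (∑-const N 1) (*-identityʳ N) ⟩
    N                                  ∎
    where open ≡-Reasoning

  g^-surjective : ∀ x → 0 < x → x < p → ∃ λ n → n < N × g^ n ≡ x
  g^-surjective (suc x) _ 1+x<p with hits (suc x) ≟ 0
  ... | yes hits≡0 =
    ⊥-elim (<-irrefl ∑-hits (∑-<-length N (λ x → hits (suc x)) (λ x _ → hits≤1 (suc x)) x x<N hits≡0))
    where
    x<N : x < N
    x<N = ≤-pred (subst (suc x <_) (sym 1+N≡p) 1+x<p)
  ... | no hits≢0 with ∑-pos N (λ n → 𝟙 (g^ n ≟ suc x)) (n≢0⇒n>0 hits≢0)
  ...   | n , n<N , 1≤𝟙 = n , n<N , 𝟙-pos (g^ n ≟ suc x) 1≤𝟙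

  search : ℕ → ℕ → ℕ
  search zero    x = 0
  search (suc i) x with g^ i ≟ x
  ... | yes _ = i
  ... | no  _ = search i x

  search-finds : ∀ i x n → n < i → g^ n ≡ x → g^ (search i x) ≡ x × search i x < i
  search-finds (suc i) x n n<1+i g^n≡x with g^ i ≟ x
  ... | yes g^i≡x = g^i≡x , ≤-refl
  ... | no g^i≢x with n ≟ i
  ...   | yes refl = ⊥-elim (g^i≢x g^n≡x)
  ...   | no n≢i   with search-finds i x n (≤∧≢⇒< (≤-pred n<1+i) n≢i) g^n≡x
  ...     | found , search<i = found , m≤n⇒m≤1+n search<i

  log : ℕ → ℕ
  log x = search N x

  log-spec : ∀ {x} → 0 < x → x < p → g^ (log x) ≡ x × log x < N
  log-spec {x} 0<x x<p with g^-surjective x 0<x x<p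
  ... | n , n<N , g^n≡x = search-finds N x n n<N g^n≡x

  g^-log : ∀ {x} → 0 < x → x < p → g^ (log x) ≡ x
  g^-log 0<x x<p = proj₁ (log-spec 0<x x<p)

  log<N : ∀ {x} → 0 < x → x < p → log x < N
  log<N 0<x x<p = proj₂ (log-spec 0<x x<p)

  log-g^ : ∀ n → log (g^ n) ≡ n % N
  log-g^ n = g^-injective (log<N 0<g^n (g^<p n)) (m%n<n n N) (trans (g^-log 0<g^n (g^<p n)) (g^-%N n))
    where
    0<g^n : 0 < g^ n
    0<g^n = n≢0⇒n>0 (g^≢0 n)

  inv : ℕ → ℕ
  inv x = g^ (N ∸ log x)

  *-inv : ∀ {x} → 0 < x → x < p → (x * inv x) % p ≡ 1
  *-inv {x} 0<x x<p = begin
    (x * inv x) % p                    ≡⟨ cong (λ y → (y * inv x) % p) (sym (g^-log 0<x x<p)) ⟩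
    (g^ (log x) * g^ (N ∸ log x)) % p  ≡⟨ sym (g^-+ (log x) (N ∸ log x)) ⟩
    g^ (log x + (N ∸ log x))           ≡⟨ cong g^_ (m+[n∸m]≡n (<⇒≤ (log<N 0<x x<p))) ⟩
    g^ N                               ≡⟨ g^N≡1 ⟩
    1                                  ∎
    where open ≡-Reasoning

module Cosets (m p g : ℕ) .{{_ : NonZero m}} .{{_ : NonZero p}} (prime : Prime p)
  (g-primitive : IsPrimitiveRoot p g) (m∣p-1 : m ∣ p ∸ 1) where

  open import Data.Nat
  open import Data.Nat.Properties
  open import Data.Nat.DivMod
  open import Data.Nat.Divisibility
  open import Data.Product using (_×_; _,_; ∃; ∃₂; proj₁; proj₂)
  open import Data.Sum using (inj₁; inj₂)
  open import Data.Empty using (⊥-elim)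
  open import Relation.Nullary using (¬_; Dec; yes; no)
  open import Relation.Nullary.Decidable using (¬?; _×-dec_)
  open import Relation.Binary.PropositionalEquality
  open import Function.Bundles using (_⇔_; Equivalence)
  open import Algebra.Properties.CommutativeSemigroup +-commutativeSemigroup using (x∙yz≈y∙xz)
  open import Data.Nat.Tactic.RingSolver using (solve-∀)
  open FiniteSums
  open ModularArithmetic
  open Cyclic p g prime g-primitive public

  k : ℕ
  k = N / m

  N≡k*m : N ≡ k * m
  N≡k*m = sym (m/n*n≡m m∣p-1)

  0<m : 0 < m
  0<m = n≢0⇒n>0 (≢-nonZero⁻¹ m)

  0<k : 0 < k
  0<k = m≥n⇒m/n>0 (∣⇒≤ m∣p-1)

  class : ℕ → ℕ
  class x = log x % m

  class<m : ∀ x → class x < m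
  class<m x = m%n<n (log x) m

  class-g^ : ∀ n → class (g^ n) ≡ n % m
  class-g^ n = trans (cong (_% m) (log-g^ n)) (m∣n⇒o%n%m≡o%m m N n m∣p-1)

  [am+i]%m≡i : ∀ a i → i < m → (a * m + i) % m ≡ i
  [am+i]%m≡i a i i<m =
    trans (cong (_% m) (+-comm (a * m) i)) (trans ([m+kn]%n≡m%n i a m) (m<n⇒m%n≡m i<m))

  InCoset⇒class : ∀ {i x} → i < m → InCoset p m g i x → x ≢ 0 × class x ≡ i
  InCoset⇒class {i} i<m (a , _ , refl) =
    g^≢0 (a * m + i) , trans (class-g^ (a * m + i)) ([am+i]%m≡i a i i<m)

  InCoset⇒<p : ∀ {i x} → InCoset p m g i x → x < p
  InCoset⇒<p {i} (a , _ , refl) = g^<p (a * m + i)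

  class⇒InCoset : ∀ {i x} → x < p → x ≢ 0 → class x ≡ i → InCoset p m g i x
  class⇒InCoset {i} {x} x<p x≢0 refl = log x / m , log/m<k , (begin
    g^ (log x / m * m + log x % m)
      ≡⟨ cong g^_ (trans (+-comm (log x / m * m) _) (sym (m≡m%n+[m/n]*n (log x) m))) ⟩
    g^ (log x)                     ≡⟨ g^-log (n≢0⇒n>0 x≢0) x<p ⟩
    x                              ∎)
    where
    open ≡-Reasoning
    log/m<k : log x / m < k
    log/m<k = m<n*o⇒m/o<n (subst (log x <_) N≡k*m (log<N (n≢0⇒n>0 x≢0) x<p))

  class-* : ∀ {a b} → 0 < a → a < p → 0 < b → b < p →
            class ((a * b) % p) ≡ (class a + class b) % m
  class-* {a} {b} 0<a a<p 0<b b<p = begin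
    class ((a * b) % p)                     ≡⟨ cong (λ x → class ((x * b) % p)) (sym (g^-log 0<a a<p)) ⟩
    class ((g^ (log a) * b) % p)
      ≡⟨ cong (λ x → class ((g^ (log a) * x) % p)) (sym (g^-log 0<b b<p)) ⟩
    class ((g^ (log a) * g^ (log b)) % p)   ≡⟨ cong class (sym (g^-+ (log a) (log b))) ⟩
    class (g^ (log a + log b))              ≡⟨ class-g^ (log a + log b) ⟩
    (log a + log b) % m                     ≡⟨ %-distribˡ-+ (log a) (log b) m ⟩
    (class a + class b) % m                 ∎
    where open ≡-Reasoning

  class-1 : class 1 ≡ 0
  class-1 = trans (cong class (sym g^0≡1)) (trans (class-g^ 0) (m<n⇒m%n≡m 0<m))

  class-inv : ∀ {x} → 0 < x → x < p → class x ≡ 0 → class (inv x) ≡ 0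
  class-inv {x} 0<x x<p class≡0 = trans (class-g^ (N ∸ log x)) (n∣m⇒m%n≡0 _ m m∣N∸logx)
    where
    m∣N∸logx : m ∣ N ∸ log x
    m∣N∸logx = %≡⇒∣∸ m (<⇒≤ (log<N 0<x x<p)) (trans class≡0 (sym (n∣m⇒m%n≡0 N m m∣p-1)))

  g^-cong : ∀ {a b} → a % N ≡ b % N → g^ a ≡ g^ b
  g^-cong {a} {b} a≡b = trans (g^-%N a) (trans (cong g^_ a≡b) (sym (g^-%N b)))

  -- y ∈ x X₀, witnessed by the exponent D = log y + N − log x, which m divides.
  same-class⇒translate : ∀ {x y} → 0 < x → x < p → 0 < y → y < p → class y ≡ class x →
    ∃ λ d → d < k × (x * g^ (d * m)) % p ≡ y
  same-class⇒translate {x} {y} 0<x x<p 0<y y<p classes≡ = d , d<k , (begin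
    (x * g^ (d * m)) % p              ≡⟨ cong (λ z → (z * g^ (d * m)) % p) (sym (g^-log 0<x x<p)) ⟩
    (g^ (log x) * g^ (d * m)) % p     ≡⟨ sym (g^-+ (log x) (d * m)) ⟩
    g^ (log x + d * m)                ≡⟨ cong (λ e → g^ (log x + e)) (m/n*n≡m m∣D%N) ⟩
    g^ (log x + D % N)                ≡⟨ g^-cong ([m+o%n]%n≡[m+o]%n N (log x) D) ⟩
    g^ (log x + D)                    ≡⟨ cong g^_ logx+D≡logy+N ⟩
    g^ (log y + N)                    ≡⟨ g^-periodic (log y) ⟩
    g^ (log y)                        ≡⟨ g^-log 0<y y<p ⟩
    y                                 ∎)
    where
    open ≡-Reasoning
    logx≤N : log x ≤ N
    logx≤N = <⇒≤ (log<N 0<x x<p)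
    D : ℕ
    D = log y + (N ∸ log x)
    logx+D≡logy+N : log x + D ≡ log y + N
    logx+D≡logy+N = trans (x∙yz≈y∙xz (log x) (log y) _) (cong (log y +_) (m+[n∸m]≡n logx≤N))
    m∣D : m ∣ D
    m∣D = subst (m ∣_) (+-∸-assoc (log y) logx≤N) (%≡⇒∣∸ m (≤-trans logx≤N (m≤n+m N (log y)))
      (trans (sym classes≡) (sym (%-remove-+ʳ (log y) m∣p-1))))
    m∣D%N : m ∣ D % N
    m∣D%N = m%n≡0⇒n∣m _ m (trans (m∣n⇒o%n%m≡o%m m N D m∣p-1) (n∣m⇒m%n≡0 D m m∣D))
    d : ℕ
    d = D % N / m
    d<k : d < k
    d<k = m<n*o⇒m/o<n (subst (D % N <_) N≡k*m (m%n<n D N))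

  NegationClosed SelfSumComplement CrossSumFull : Set
  NegationClosed =
    ∀ i → i < m → ∀ x → x < p → InCoset p m g i x ⇔ InCoset p m g i ((p ∸ x) % p)
  SelfSumComplement =
    ∀ i → i < m → ∀ x → x < p → InSumset p m g i i x ⇔ (¬ InCoset p m g i x)
  CrossSumFull =
    ∀ i j → i < m → j < m → i ≢ j → ∀ x → x < p → InSumset p m g i j x ⇔ (x ≢ 0)

  1∈X₀ : InCoset p m g 0 1
  1∈X₀ = class⇒InCoset (1<p p prime) (λ ()) class-1

  negation-closed⇒class-neg : NegationClosed →
    ∀ {z} → InCoset p m g 0 z → p ∸ z < p × class (p ∸ z) ≡ 0
  negation-closed⇒class-neg negation-closed {z} z∈X₀ =
    p∸z<p , proj₂ (InCoset⇒class 0<m (subst (InCoset p m g 0) (m<n⇒m%n≡m p∸z<p) -z∈X₀))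
    where
    z<p : z < p
    z<p = InCoset⇒<p z∈X₀
    p∸z<p : p ∸ z < p
    p∸z<p = ∸-monoʳ-< {o = 0} (n≢0⇒n>0 (proj₁ (InCoset⇒class 0<m z∈X₀))) (<⇒≤ z<p)
    -z∈X₀ : InCoset p m g 0 ((p ∸ z) % p)
    -z∈X₀ = Equivalence.to (negation-closed 0 0<m z z<p) z∈X₀

  negation-closed⇒class-[-1]≡0 : NegationClosed → class N ≡ 0
  negation-closed⇒class-[-1]≡0 negation-closed = proj₂ (negation-closed⇒class-neg negation-closed 1∈X₀)

  self-sum⇒class-suc≢0 : SelfSumComplement →
    ∀ x → x ≢ 0 → suc x < p → class x ≡ 0 → class (suc x) ≢ 0
  self-sum⇒class-suc≢0 self-sum x x≢0 1+x<p class≡0 class-suc≡0 =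
    Equivalence.to (self-sum 0 0<m (suc x) 1+x<p) x+1∈X₀+X₀ (class⇒InCoset 1+x<p (λ ()) class-suc≡0)
    where
    x+1∈X₀+X₀ : InSumset p m g 0 0 (suc x)
    x+1∈X₀+X₀ = x , 1 , class⇒InCoset (<⇒≤ 1+x<p) x≢0 class≡0 , 1∈X₀ ,
                trans (cong (_% p) (+-comm x 1)) (m<n⇒m%n≡m 1+x<p)

  -- 1 = y + z with y ∈ Xⱼ and z ∈ X₀, so x = −z ∈ X₀ has x + 1 = y.
  cross-sum⇒class-shift : NegationClosed → CrossSumFull →
    ∀ j → j < m → j ≢ 0 → ∃ λ x → x ≢ 0 × suc x < p × class x ≡ 0 × class (suc x) ≡ j
  cross-sum⇒class-shift negation-closed cross-sum j j<m j≢0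
    with Equivalence.from (cross-sum j 0 j<m 0<m j≢0 1 (1<p p prime)) (λ ())
  ... | y , z , y∈Xⱼ , z∈X₀ , y+z≡1 =
    p ∸ z , x≢0 , 1+x<p , proj₂ (negation-closed⇒class-neg negation-closed z∈X₀) , class-suc≡j
    where
    x : ℕ
    x = p ∸ z
    y<p : y < p
    y<p = InCoset⇒<p y∈Xⱼ
    z<p : z < p
    z<p = InCoset⇒<p z∈X₀
    x≢0 : x ≢ 0
    x≢0 x≡0 = <-irrefl (trans (sym (m∸[m∸n]≡n (<⇒≤ z<p))) (cong (p ∸_) x≡0)) z<p
    [1+x]+z≡1 : (suc x + z) % p ≡ 1
    [1+x]+z≡1 = begin
      (suc x + z) % p  ≡⟨ cong (λ w → suc w % p) (m∸n+n≡m (<⇒≤ z<p)) ⟩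
      suc p % p        ≡⟨ [m+n]%n≡m%n 1 p ⟩
      1 % p            ≡⟨ 1%p≡1 p prime ⟩
      1                ∎
      where open ≡-Reasoning
    [1+x]%p≡y : suc x % p ≡ y
    [1+x]%p≡y = trans (+-cancelʳ-% p z (suc x) y (trans [1+x]+z≡1 (sym y+z≡1))) (m<n⇒m%n≡m y<p)
    1+x<p : suc x < p
    1+x<p with suc x ≟ p
    ... | yes 1+x≡p = ⊥-elim (proj₁ (InCoset⇒class j<m y∈Xⱼ)
                                (trans (sym [1+x]%p≡y) (trans (cong (_% p) 1+x≡p) (n%n≡0 p))))
    ... | no 1+x≢p  = ≤∧≢⇒< (proj₁ (negation-closed⇒class-neg negation-closed z∈X₀)) 1+x≢p
    class-suc≡j : class (suc x) ≡ j
    class-suc≡j = trans (cong class (trans (sym (m<n⇒m%n≡m 1+x<p)) [1+x]%p≡y))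
                        (proj₂ (InCoset⇒class j<m y∈Xⱼ))

  module LowerBound (class-[-1]≡0 : class N ≡ 0)
      (class-shift : ∀ j → j < m → j ≢ 0 →
                   ∃ λ x → x ≢ 0 × suc x < p × class x ≡ 0 × class (suc x) ≡ j) where

    InX₀ Shiftable : ℕ → Set
    InX₀ x = x ≢ 0 × class x ≡ 0
    Shiftable x = x ≢ 0 × suc x < p × class x ≡ 0

    inX₀? : ∀ x → Dec (InX₀ x)
    inX₀? x = ¬? (x ≟ 0) ×-dec (class x ≟ 0)

    shiftable? : ∀ x → Dec (Shiftable x)
    shiftable? x = ¬? (x ≟ 0) ×-dec (suc x <? p) ×-dec (class x ≟ 0)

    ∑-inX₀≤k : ∑[ x < p ] 𝟙 (inX₀? x) ≤ k
    ∑-inX₀≤k = begin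
      ∑[ x < p ] 𝟙 (inX₀? x)
        ≤⟨ ∑-≤-cover p k 1 (λ x → 𝟙 (inX₀? x)) (λ _ _ → 1) (λ a _ → g^ (a * m + 0))
                     (λ x _ → 𝟙≤1 (inX₀? x)) covered ⟩
      ∑[ _ < k ] 1
        ≡⟨ trans (∑-const k 1) (*-identityʳ k) ⟩
      k ∎
      where
      open ≤-Reasoning
      covered : ∀ x → x < p → 1 ≤ 𝟙 (inX₀? x) →
                ∃₂ λ a e → a < k × e < 1 × 1 ≤ 1 × g^ (a * m + 0) ≡ x
      covered x x<p 1≤𝟙 with 𝟙-pos (inX₀? x) 1≤𝟙
      ... | x≢0 , class≡0 with class⇒InCoset x<p x≢0 class≡0
      ...   | a , a<k , g^≡x = a , 0 , a<k , s≤s z≤n , ≤-refl , g^≡x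

    ∑-shiftable<k : ∑[ x < p ] 𝟙 (shiftable? x) < k
    ∑-shiftable<k = begin
      suc (∑[ x < p ] 𝟙 (shiftable? x))
        ≡⟨ +-comm 1 _ ⟩
      ∑[ x < p ] 𝟙 (shiftable? x) + 1
        ≡⟨ cong (∑[ x < p ] 𝟙 (shiftable? x) +_) (sym (∑-𝟙-≟ p N N<p)) ⟩
      ∑[ x < p ] 𝟙 (shiftable? x) + ∑[ x < p ] 𝟙 (N ≟ x)
        ≡⟨ sym (∑-distrib-+ p _ _) ⟩
      ∑[ x < p ] (𝟙 (shiftable? x) + 𝟙 (N ≟ x))
        ≤⟨ ∑-mono-≤ p (λ x _ → pointwise x) ⟩
      ∑[ x < p ] 𝟙 (inX₀? x)
        ≤⟨ ∑-inX₀≤k ⟩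
      k ∎
      where
      open ≤-Reasoning
      N-unshiftable : ¬ Shiftable N
      N-unshiftable (_ , 1+N<p , _) = <-irrefl 1+N≡p 1+N<p
      N∈X₀ : InX₀ N
      N∈X₀ = (λ N≡0 → <-irrefl (sym N≡0) 0<N) , class-[-1]≡0
      pointwise : ∀ x → 𝟙 (shiftable? x) + 𝟙 (N ≟ x) ≤ 𝟙 (inX₀? x)
      pointwise x with N ≟ x
      ... | yes refl = ≤-reflexive (trans (cong (_+ 1) (𝟙-no (shiftable? N) N-unshiftable))
                                          (sym (𝟙-yes (inX₀? N) N∈X₀)))
      ... | no _     = ≤-trans (≤-reflexive (+-identityʳ _))
                               (𝟙-mono (shiftable? x) (inX₀? x) (λ (x≢0 , _ , class≡0) → x≢0 , class≡0))

    shift : ℕ → ℕ → ℕ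
    shift j x = 𝟙 (shiftable? x) * 𝟙 (class (suc x) ≟ j)

    shifts : ℕ → ℕ
    shifts j = ∑[ x < p ] shift j x

    shift≡1 : ∀ {x j} → Shiftable x → class (suc x) ≡ j → shift j x ≡ 1
    shift≡1 {x} {j} x-shiftable class-suc≡j =
      cong₂ _*_ (𝟙-yes (shiftable? x) x-shiftable) (𝟙-yes (class (suc x) ≟ j) class-suc≡j)

    ∑-shifts : ∑[ j < m ] shifts j ≡ ∑[ x < p ] 𝟙 (shiftable? x)
    ∑-shifts = trans (∑-comm m p shift) (∑-cong p λ x _ → begin
      ∑[ j < m ] (𝟙 (shiftable? x) * 𝟙 (class (suc x) ≟ j))
        ≡⟨ ∑-*ˡ m (𝟙 (shiftable? x)) (λ j → 𝟙 (class (suc x) ≟ j)) ⟩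
      𝟙 (shiftable? x) * ∑[ j < m ] 𝟙 (class (suc x) ≟ j)
        ≡⟨ cong (𝟙 (shiftable? x) *_) (∑-𝟙-≟ m _ (class<m (suc x))) ⟩
      𝟙 (shiftable? x) * 1
        ≡⟨ *-identityʳ _ ⟩
      𝟙 (shiftable? x) ∎)
      where open ≡-Reasoning

    -- The inverse of a shiftable x works for the same j: x⁻¹ + 1 = x⁻¹ (x + 1).
    inv-shiftable : ∀ {x j} → Shiftable x → class (suc x) ≡ j → x ≢ 1 →
      Shiftable (inv x) × class (suc (inv x)) ≡ j × inv x ≢ x
    inv-shiftable {x} {j} (x≢0 , 1+x<p , class≡0) class-suc≡j x≢1 =
      (x⁻¹≢0 , 1+x⁻¹<p , class⁻¹≡0) , class-suc⁻¹≡j , x⁻¹≢x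
      where
      0<x : 0 < x
      0<x = n≢0⇒n>0 x≢0
      x<p : x < p
      x<p = <⇒≤ 1+x<p
      x⁻¹ : ℕ
      x⁻¹ = inv x
      x⁻¹≢0 : x⁻¹ ≢ 0
      x⁻¹≢0 = g^≢0 (N ∸ log x)
      x⁻¹<p : x⁻¹ < p
      x⁻¹<p = g^<p (N ∸ log x)
      class⁻¹≡0 : class x⁻¹ ≡ 0
      class⁻¹≡0 = class-inv 0<x x<p class≡0
      x⁻¹[1+x]≡1+x⁻¹ : (x⁻¹ * suc x) % p ≡ suc x⁻¹ % p
      x⁻¹[1+x]≡1+x⁻¹ = begin
        (x⁻¹ * suc x) % p               ≡⟨ cong (_% p) (trans (*-suc x⁻¹ x) (+-comm x⁻¹ _)) ⟩
        (x⁻¹ * x + x⁻¹) % p             ≡⟨ sym ([m%n+o]%n≡[m+o]%n p (x⁻¹ * x) x⁻¹) ⟩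
        ((x⁻¹ * x) % p + x⁻¹) % p       ≡⟨ cong (λ r → (r % p + x⁻¹) % p) (*-comm x⁻¹ x) ⟩
        ((x * x⁻¹) % p + x⁻¹) % p       ≡⟨ cong (λ r → (r + x⁻¹) % p) (*-inv 0<x x<p) ⟩
        suc x⁻¹ % p                     ∎
        where open ≡-Reasoning
      1+x⁻¹<p : suc x⁻¹ < p
      1+x⁻¹<p = ≤∧≢⇒< x⁻¹<p λ 1+x⁻¹≡p →
        *-%≢0 p prime x⁻¹ (suc x) (g^%p≢0 (N ∸ log x))
                                  (<∧≢0⇒%≢0 p 1+x<p (λ ()))
              (trans x⁻¹[1+x]≡1+x⁻¹ (trans (cong (_% p) 1+x⁻¹≡p) (n%n≡0 p)))
      class-suc⁻¹≡j : class (suc x⁻¹) ≡ j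
      class-suc⁻¹≡j = begin
        class (suc x⁻¹)
          ≡⟨ cong class (trans (sym (m<n⇒m%n≡m 1+x⁻¹<p)) (sym x⁻¹[1+x]≡1+x⁻¹)) ⟩
        class ((x⁻¹ * suc x) % p)
          ≡⟨ class-* (n≢0⇒n>0 x⁻¹≢0) x⁻¹<p (s≤s z≤n) 1+x<p ⟩
        (class x⁻¹ + class (suc x)) % m
          ≡⟨ cong₂ (λ a b → (a + b) % m) class⁻¹≡0 class-suc≡j ⟩
        j % m
          ≡⟨ m<n⇒m%n≡m (subst (_< m) class-suc≡j (class<m (suc x))) ⟩
        j                               ∎
        where open ≡-Reasoning
      x⁻¹≢x : x⁻¹ ≢ x
      x⁻¹≢x x⁻¹≡x
        with x²≡1⇒x≡±1 p prime x 0<x x<p (subst (λ y → (x * y) % p ≡ 1) x⁻¹≡x (*-inv 0<x x<p))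
      ... | inj₁ x≡1   = x≢1 x≡1
      ... | inj₂ 1+x≡p = <-irrefl 1+x≡p 1+x<p

    2≤shifts : ∀ {x j} → Shiftable x → class (suc x) ≡ j → x ≢ 1 → 2 ≤ shifts j
    2≤shifts {x} {j} x-shiftable@(_ , 1+x<p , _) class-suc≡j x≢1
      with inv-shiftable x-shiftable class-suc≡j x≢1
    ... | x⁻¹-shiftable@(_ , 1+x⁻¹<p , _) , class-suc⁻¹≡j , x⁻¹≢x = begin
      2
        ≡⟨ sym (cong₂ _+_ (shift≡1 x-shiftable class-suc≡j) (shift≡1 x⁻¹-shiftable class-suc⁻¹≡j)) ⟩
      shift j x + shift j (inv x)
        ≤⟨ pair≤∑ p (shift j) x (inv x) (<⇒≤ 1+x<p) (<⇒≤ 1+x⁻¹<p) (≢-sym x⁻¹≢x) ⟩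
      shifts j ∎
      where open ≤-Reasoning

    -- Each j ≢ 0 is reached from some x ∈ X₀ and also from x⁻¹ ≠ x, unless x = 1, i.e. j = class 2.
    two≤shifts : ∀ j → j < m → 2 ≤ shifts j + 𝟙 (class 2 ≟ j) + 2 * 𝟙 (0 ≟ j)
    two≤shifts j j<m with 0 ≟ j
    ... | yes refl = m≤n+m 2 _
    ... | no 0≢j with class-shift j j<m (≢-sym 0≢j)
    ...   | x , x≢0 , 1+x<p , class≡0 , class-suc≡j with class 2 ≟ j
    ...     | yes _ = ≤-trans (+-monoˡ-≤ 1 one≤shifts) (m≤m+n _ 0)
      where
      one≤shifts : 1 ≤ shifts j
      one≤shifts = ≤-trans (≤-reflexive (sym (shift≡1 (x≢0 , 1+x<p , class≡0) class-suc≡j)))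
                           (term≤∑ p (shift j) x (<⇒≤ 1+x<p))
    ...     | no class2≢j =
      ≤-trans (2≤shifts (x≢0 , 1+x<p , class≡0) class-suc≡j λ { refl → class2≢j class-suc≡j })
              (≤-trans (m≤m+n _ 0) (m≤m+n _ 0))

    2m≤k+2 : 2 * m ≤ k + 2
    2m≤k+2 = begin
      2 * m                                                       ≡⟨ trans (*-comm 2 m) (sym (∑-const m 2)) ⟩
      ∑[ _ < m ] 2                                                ≤⟨ ∑-mono-≤ m two≤shifts ⟩
      ∑[ j < m ] (shifts j + 𝟙 (class 2 ≟ j) + 2 * 𝟙 (0 ≟ j))     ≡⟨ ∑-distrib-+ m _ _ ⟩
      ∑[ j < m ] (shifts j + 𝟙 (class 2 ≟ j)) + ∑[ j < m ] (2 * 𝟙 (0 ≟ j))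
        ≡⟨ cong₂ _+_ (∑-distrib-+ m shifts _) (∑-*ˡ m 2 _) ⟩
      (∑< m shifts + ∑[ j < m ] 𝟙 (class 2 ≟ j)) + 2 * ∑[ j < m ] 𝟙 (0 ≟ j)
        ≡⟨ cong₂ (λ a b → (∑< m shifts + a) + 2 * b) (∑-𝟙-≟ m (class 2) (class<m 2))
                                                    (∑-𝟙-≟ m 0 0<m) ⟩
      ∑< m shifts + 1 + 2                                         ≡⟨ cong (λ s → s + 1 + 2) ∑-shifts ⟩
      ∑[ x < p ] 𝟙 (shiftable? x) + 1 + 2
        ≤⟨ +-monoˡ-≤ 2 (subst (_≤ k) (+-comm 1 _) ∑-shiftable<k) ⟩
      k + 2                                                       ∎
      where open ≤-Reasoning

    lower-bound : 2 * m * m ∸ 2 * m + 1 ≤ p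
    lower-bound = begin
      2 * m * m ∸ 2 * m + 1   ≡⟨ cong₂ (λ a b → a ∸ b + 1) (*-comm (2 * m) m) (*-comm 2 m) ⟩
      m * (2 * m) ∸ m * 2 + 1 ≡⟨ cong (_+ 1) (sym (*-distribˡ-∸ m (2 * m) 2)) ⟩
      m * (2 * m ∸ 2) + 1
        ≤⟨ +-monoˡ-≤ 1 (*-monoʳ-≤ m 2m∸2≤k) ⟩
      m * k + 1               ≡⟨ cong (_+ 1) (trans (*-comm m k) (sym N≡k*m)) ⟩
      N + 1                   ≡⟨ trans (+-comm N 1) 1+N≡p ⟩
      p                       ∎
      where
      open ≤-Reasoning
      2m∸2≤k : 2 * m ∸ 2 ≤ k
      2m∸2≤k = m≤n+o⇒m∸n≤o (2 * m) 2 (subst (2 * m ≤_) (+-comm k 2) 2m≤k+2)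

  module UpperBound (class-suc≢0 : ∀ x → x ≢ 0 → suc x < p → class x ≡ 0 → class (suc x) ≢ 0) where
    open Arithmetic using (km+1≤m⁴+5)

    Consecutive : ℕ → Set
    Consecutive x = x ≢ 0 × suc x < p

    consecutive? : ∀ x → Dec (Consecutive x)
    consecutive? x = ¬? (x ≟ 0) ×-dec (suc x <? p)

    consecutive : ℕ → ℕ
    consecutive x = 𝟙 (consecutive? x)

    W : ℕ
    W = ∑[ x < p ] consecutive x

    W≡N∸1 : W ≡ N ∸ 1
    W≡N∸1 = begin
      ∑< p consecutive                              ≡⟨ cong (λ n → ∑< n consecutive) (sym 1+N≡p) ⟩
      consecutive N + ∑< N consecutive              ≡⟨ cong (_+ ∑< N consecutive) consecutive-N ⟩
      ∑< N consecutive                              ≡⟨ cong (λ n → ∑< n consecutive) (sym 1+[N∸1]≡N) ⟩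
      ∑< (suc (N ∸ 1)) consecutive                  ≡⟨ ∑-head (N ∸ 1) consecutive ⟩
      0 + ∑[ x < N ∸ 1 ] consecutive (suc x)        ≡⟨ ∑-cong (N ∸ 1) (λ x → consecutive-suc) ⟩
      ∑[ _ < N ∸ 1 ] 1                              ≡⟨ trans (∑-const (N ∸ 1) 1) (*-identityʳ _) ⟩
      N ∸ 1                                         ∎
      where
      open ≡-Reasoning
      consecutive-N : consecutive N ≡ 0
      consecutive-N = 𝟙-no (consecutive? N) λ (_ , 1+N<p) → <-irrefl 1+N≡p 1+N<p
      1+[N∸1]≡N : suc (N ∸ 1) ≡ N
      1+[N∸1]≡N = m+[n∸m]≡n 0<N
      2+x<p : ∀ {x} → x < N ∸ 1 → suc (suc x) < p
      2+x<p x<N-1 = subst (suc (suc _) <_) (trans (cong suc 1+[N∸1]≡N) 1+N≡p) (s≤s (s≤s x<N-1))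
      consecutive-suc : ∀ {x} → x < N ∸ 1 → consecutive (suc x) ≡ 1
      consecutive-suc {x} x<N-1 = 𝟙-yes (consecutive? (suc x)) ((λ ()) , 2+x<p x<N-1)

    pair : ℕ → ℕ
    pair x = class x * m + class (suc x)

    pair<m² : ∀ x → pair x < m * m
    pair<m² x = begin-strict
      class x * m + class (suc x) <⟨ +-monoʳ-< (class x * m) (class<m (suc x)) ⟩
      class x * m + m             ≡⟨ +-comm (class x * m) m ⟩
      suc (class x) * m           ≤⟨ *-monoˡ-≤ m (class<m x) ⟩
      m * m                       ∎
      where open ≤-Reasoning

    pair-injective : ∀ {x y} → pair y ≡ pair x → class y ≡ class x × class (suc y) ≡ class (suc x)
    pair-injective {x} {y} pairs≡ = *-cancelʳ-≡ (class y) (class x) m (+-cancelʳ-≡ _ _ _ high≡) , low≡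
      where
      low≡ : class (suc y) ≡ class (suc x)
      low≡ = begin
        class (suc y)       ≡⟨ sym ([am+i]%m≡i (class y) _ (class<m (suc y))) ⟩
        pair y % m          ≡⟨ cong (_% m) pairs≡ ⟩
        pair x % m          ≡⟨ [am+i]%m≡i (class x) _ (class<m (suc x)) ⟩
        class (suc x)       ∎
        where open ≡-Reasoning
      high≡ : class y * m + class (suc x) ≡ class x * m + class (suc x)
      high≡ = subst (λ c → class y * m + c ≡ pair x) low≡ pairs≡

    pairCount : ℕ → ℕ
    pairCount c = ∑[ x < p ] (consecutive x * 𝟙 (pair x ≟ c))

    ∑-pairCount : ∑[ c < m * m ] pairCount c ≡ W
    ∑-pairCount = trans (∑-comm (m * m) p _) (∑-cong p λ x _ → begin
      ∑[ c < m * m ] (consecutive x * 𝟙 (pair x ≟ c))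
        ≡⟨ ∑-*ˡ (m * m) (consecutive x) (λ c → 𝟙 (pair x ≟ c)) ⟩
      consecutive x * ∑[ c < m * m ] 𝟙 (pair x ≟ c)
        ≡⟨ cong (consecutive x *_) (∑-𝟙-≟ (m * m) (pair x) (pair<m² x)) ⟩
      consecutive x * 1                                ≡⟨ *-identityʳ _ ⟩
      consecutive x                                    ∎)
      where open ≡-Reasoning

    pairCount0≡0 : pairCount 0 ≡ 0
    pairCount0≡0 = ∑-zero p _ λ x _ → 𝟙*-vanish (consecutive? x) λ (x≢0 , 1+x<p) →
      𝟙-no (pair x ≟ 0) λ pair≡0 → class-suc≢0 x x≢0 1+x<p
        (*-cancelʳ-≡ (class x) 0 m (m+n≡0⇒m≡0 (class x * m) pair≡0)) (m+n≡0⇒n≡0 (class x * m) pair≡0)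

    W²≤ : W * W ≤ (m * m ∸ 1) * ∑[ c < m * m ] (pairCount c * pairCount c)
    W²≤ = subst (λ n → W * W ≤ (n ∸ 1) * ∑[ c < n ] (pairCount c * pairCount c)) 1+[m²∸1]≡m²
      (subst (λ w → w * w ≤ (m * m ∸ 1) * ∑[ c < suc (m * m ∸ 1) ] (pairCount c * pairCount c))
             (trans (cong (λ n → ∑< n pairCount) 1+[m²∸1]≡m²) ∑-pairCount)
             (cauchy-schwarz-vanishing-head (m * m ∸ 1) pairCount pairCount0≡0))
      where
      1+[m²∸1]≡m² : suc (m * m ∸ 1) ≡ m * m
      1+[m²∸1]≡m² = m+[n∸m]≡n (*-mono-≤ 0<m 0<m)

    ∑-pairCount² : ∑[ c < m * m ] (pairCount c * pairCount c) ≤ ∑[ x < p ] (consecutive x * pairCount (pair x))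
    ∑-pairCount² = begin
      ∑[ c < m * m ] (pairCount c * pairCount c)
        ≡⟨ ∑-cong (m * m) (λ c _ → sym (∑-*ˡ p (pairCount c) _)) ⟩
      ∑[ c < m * m ] ∑[ x < p ] (pairCount c * (consecutive x * 𝟙 (pair x ≟ c)))
        ≡⟨ ∑-comm (m * m) p _ ⟩
      ∑[ x < p ] ∑[ c < m * m ] (pairCount c * (consecutive x * 𝟙 (pair x ≟ c)))
        ≡⟨ ∑-cong p (λ x _ → trans (∑-cong (m * m) (λ c _ → rearrange (pairCount c) (consecutive x) _))
                                    (∑-*ˡ (m * m) (consecutive x) (λ c → 𝟙 (pair x ≟ c) * pairCount c))) ⟩
      ∑[ x < p ] (consecutive x * ∑[ c < m * m ] (𝟙 (pair x ≟ c) * pairCount c))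
        ≤⟨ ∑-mono-≤ p (λ x _ → *-monoʳ-≤ (consecutive x) (∑-𝟙-≟-* (m * m) (pair x) pairCount)) ⟩
      ∑[ x < p ] (consecutive x * pairCount (pair x)) ∎
      where
      open ≤-Reasoning
      rearrange : ∀ a b c → a * (b * c) ≡ b * (c * a)
      rearrange = solve-∀

    t : ℕ → ℕ
    t d = g^ (d * m)

    t≡1⇒≡0 : ∀ {d} → d < k → t d % p ≡ 1 % p → d ≡ 0
    t≡1⇒≡0 {d} d<k td≡1 = *-cancelʳ-≡ d 0 m (g^≡1⇒≡0 (d * m) dm<N g^dm≡1)
      where
      g^dm≡1 : g^ (d * m) ≡ 1
      g^dm≡1 = trans (sym (g^-%p (d * m))) (trans td≡1 (1%p≡1 p prime))
      dm<N : d * m < N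
      dm<N = subst (d * m <_) (sym N≡k*m) (*-monoˡ-< m d<k)

    Solves : ℕ → ℕ → ℕ → Set
    Solves x d e = (x * t d + 1) % p ≡ (suc x * t e) % p

    solves? : ∀ x d e → Dec (Solves x d e)
    solves? x d e = (x * t d + 1) % p ≟ (suc x * t e) % p

    -- Equal pairs mean y = x tᵈ and y + 1 = (x + 1) tᵉ, so y is determined by a solution (d, e).
    pairCount-pair≤ : ∀ {x} → Consecutive x →
                      pairCount (pair x) ≤ ∑[ d < k ] ∑[ e < k ] 𝟙 (solves? x d e)
    pairCount-pair≤ {x} (x≢0 , 1+x<p) =
      ∑-≤-cover p k k _ (λ d e → 𝟙 (solves? x d e)) (λ d _ → (x * t d) % p)
                (λ y _ → 𝟙*𝟙≤1 (consecutive? y) (pair y ≟ pair x)) covered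
      where
      covered : ∀ y → y < p → 1 ≤ consecutive y * 𝟙 (pair y ≟ pair x) →
                ∃₂ λ d e → d < k × e < k × 1 ≤ 𝟙 (solves? x d e) × (x * t d) % p ≡ y
      covered y _ 1≤𝟙 with 𝟙*𝟙-pos (consecutive? y) (pair y ≟ pair x) 1≤𝟙
      ... | (y≢0 , 1+y<p) , pairs≡ with pair-injective pairs≡
      ...   | classes≡ , suc-classes≡
        with same-class⇒translate (n≢0⇒n>0 x≢0) (<⇒≤ 1+x<p) (n≢0⇒n>0 y≢0) (<⇒≤ 1+y<p) classes≡
           | same-class⇒translate (s≤s z≤n) 1+x<p (s≤s z≤n) 1+y<p suc-classes≡
      ...     | d , d<k , xtᵈ≡y | e , e<k , [1+x]tᵉ≡1+y =
        d , e , d<k , e<k , ≤-reflexive (sym (𝟙-yes (solves? x d e) solves)) , xtᵈ≡y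
        where
        solves : Solves x d e
        solves = begin
          (x * t d + 1) % p       ≡⟨ sym ([m%n+o]%n≡[m+o]%n p (x * t d) 1) ⟩
          ((x * t d) % p + 1) % p ≡⟨ cong (λ z → (z + 1) % p) xtᵈ≡y ⟩
          (y + 1) % p             ≡⟨ cong (_% p) (+-comm y 1) ⟩
          suc y % p               ≡⟨ m<n⇒m%n≡m 1+y<p ⟩
          suc y                   ≡⟨ sym [1+x]tᵉ≡1+y ⟩
          (suc x * t e) % p       ∎
          where open ≡-Reasoning

    solutions : ℕ → ℕ → ℕ
    solutions d e = ∑[ x < p ] (consecutive x * 𝟙 (solves? x d e))

    ∑-pairCount²≤∑-solutions :
      ∑[ c < m * m ] (pairCount c * pairCount c) ≤ ∑[ d < k ] ∑[ e < k ] solutions d e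
    ∑-pairCount²≤∑-solutions = begin
      ∑[ c < m * m ] (pairCount c * pairCount c)
        ≤⟨ ∑-pairCount² ⟩
      ∑[ x < p ] (consecutive x * pairCount (pair x))
        ≤⟨ ∑-mono-≤ p (λ x _ → 𝟙*-mono (consecutive? x) pairCount-pair≤) ⟩
      ∑[ x < p ] (consecutive x * ∑[ d < k ] ∑[ e < k ] 𝟙 (solves? x d e))
        ≡⟨ ∑-cong p (λ x _ → sym (∑∑-*ˡ k k (consecutive x) λ d e → 𝟙 (solves? x d e))) ⟩
      ∑[ x < p ] ∑[ d < k ] ∑[ e < k ] (consecutive x * 𝟙 (solves? x d e))
        ≡⟨ trans (∑-comm p k _) (∑-cong k (λ d _ → ∑-comm p k _)) ⟩
      ∑[ d < k ] ∑[ e < k ] solutions d e ∎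
      where open ≤-Reasoning

    solutions00≤W : solutions 0 0 ≤ W
    solutions00≤W = ∑-mono-≤ p λ x _ →
      ≤-trans (*-monoʳ-≤ (consecutive x) (𝟙≤1 (solves? x 0 0))) (≤-reflexive (*-identityʳ _))

    solutions0e≡0 : ∀ {e} → 0 < e → e < k → solutions 0 e ≡ 0
    solutions0e≡0 {e} 0<e e<k = ∑-zero p _ λ x _ → 𝟙*-vanish (consecutive? x) λ (_ , 1+x<p) →
      𝟙-no (solves? x 0 e) λ solves → <-irrefl (sym (t≡1⇒≡0 e<k (sym (1≡tᵉ 1+x<p solves)))) 0<e
      where
      1≡tᵉ : ∀ {x} → suc x < p → Solves x 0 e → 1 % p ≡ t e % p
      1≡tᵉ {x} 1+x<p solves = *-cancelˡ-% p prime (suc x) 1 (t e) (<∧≢0⇒%≢0 p 1+x<p (λ ()))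
        (trans (cong (_% p) (trans (+-comm 1 (x * 1)) (cong (λ r → x * r + 1) (sym g^0≡1)))) solves)

    solutionsd0≡0 : ∀ {d} → 0 < d → d < k → solutions d 0 ≡ 0
    solutionsd0≡0 {d} 0<d d<k = ∑-zero p _ λ x _ → 𝟙*-vanish (consecutive? x) λ (x≢0 , 1+x<p) →
      𝟙-no (solves? x d 0) λ solves → <-irrefl (sym (t≡1⇒≡0 d<k (tᵈ≡1 x≢0 1+x<p solves))) 0<d
      where
      tᵈ≡1 : ∀ {x} → x ≢ 0 → suc x < p → Solves x d 0 → t d % p ≡ 1 % p
      tᵈ≡1 {x} x≢0 1+x<p solves = *-cancelˡ-% p prime x (t d) 1 (<∧≢0⇒%≢0 p (<⇒≤ 1+x<p) x≢0)
        (+-cancelʳ-% p 1 (x * t d) (x * 1)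
          (trans solves (cong (_% p) (trans (cong (suc x *_) g^0≡1) (+-comm 1 (x * 1))))))

    -- For d ≠ 0 the congruence x tᵈ + 1 ≡ (x + 1) tᵉ is linear in x with nonzero slope.
    solves-unique : ∀ {x δ d e} → 0 < d → d < k → x + δ < p →
                    Solves x d e → Solves (x + δ) d e → δ ≡ 0
    solves-unique {x} {δ} {d} {e} 0<d d<k x+δ<p solves solves′ with δ ≟ 0
    ... | yes δ≡0 = δ≡0
    ... | no δ≢0  = ⊥-elim (<-irrefl (sym (t≡1⇒≡0 d<k tᵈ≡1)) 0<d)
      where
      open ≡-Reasoning
      δtᵈ≡δtᵉ : (δ * t d) % p ≡ (δ * t e) % p
      δtᵈ≡δtᵉ = +-cancelʳ-% p (suc x * t e) (δ * t d) (δ * t e) (begin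
        (δ * t d + suc x * t e) % p              ≡⟨ cong (_% p) (+-comm (δ * t d) _) ⟩
        (suc x * t e + δ * t d) % p              ≡⟨ sym ([m%n+o]%n≡[m+o]%n p (suc x * t e) (δ * t d)) ⟩
        ((suc x * t e) % p + δ * t d) % p        ≡⟨ cong (λ r → (r + δ * t d) % p) (sym solves) ⟩
        ((x * t d + 1) % p + δ * t d) % p        ≡⟨ [m%n+o]%n≡[m+o]%n p (x * t d + 1) (δ * t d) ⟩
        (x * t d + 1 + δ * t d) % p              ≡⟨ cong (_% p) (shift-left x δ (t d)) ⟩
        ((x + δ) * t d + 1) % p                  ≡⟨ solves′ ⟩
        (suc (x + δ) * t e) % p                  ≡⟨ cong (_% p) (shift-right x δ (t e)) ⟩
        (δ * t e + suc x * t e) % p              ∎)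
        where
        shift-left : ∀ x δ a → x * a + 1 + δ * a ≡ (x + δ) * a + 1
        shift-left = solve-∀
        shift-right : ∀ x δ a → suc (x + δ) * a ≡ δ * a + suc x * a
        shift-right = solve-∀
      δ<p : δ < p
      δ<p = ≤-<-trans (m≤n+m δ x) x+δ<p
      tᵈ≡tᵉ : t d ≡ t e
      tᵈ≡tᵉ = trans (sym (g^-%p (d * m)))
        (trans (*-cancelˡ-% p prime δ (t d) (t e) (<∧≢0⇒%≢0 p δ<p δ≢0) δtᵈ≡δtᵉ)
               (g^-%p (e * m)))
      tᵈ≡1 : t d % p ≡ 1 % p
      tᵈ≡1 = sym (+-cancelʳ-% p (x * t d) 1 (t d) (begin
        (1 + x * t d) % p   ≡⟨ cong (_% p) (+-comm 1 (x * t d)) ⟩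
        (x * t d + 1) % p   ≡⟨ solves ⟩
        (suc x * t e) % p   ≡⟨ cong (λ r → (suc x * r) % p) (sym tᵈ≡tᵉ) ⟩
        (t d + x * t d) % p ∎))

    solutions≤1 : ∀ {d} e → 0 < d → d < k → solutions d e ≤ 1
    solutions≤1 {d} e 0<d d<k = ∑-≤1 p _ (λ x _ → 𝟙*𝟙≤1 (consecutive? x) (solves? x d e)) unique
      where
      solves-of : ∀ x → 1 ≤ consecutive x * 𝟙 (solves? x d e) → Solves x d e
      solves-of x 1≤𝟙 = proj₂ (𝟙*𝟙-pos (consecutive? x) (solves? x d e) 1≤𝟙)
      ordered : ∀ {x y} → x ≤ y → x < p × y < p × Solves x d e × Solves y d e → x ≡ y
      ordered {x} {y} x≤y (_ , y<p , solves-x , solves-y) = begin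
        x               ≡⟨ sym (+-identityʳ x) ⟩
        x + 0           ≡⟨ cong (x +_) (sym δ≡0) ⟩
        x + (y ∸ x)     ≡⟨ m+[n∸m]≡n x≤y ⟩
        y               ∎
        where
        open ≡-Reasoning
        y≡x+δ : y ≡ x + (y ∸ x)
        y≡x+δ = sym (m+[n∸m]≡n x≤y)
        δ≡0 : y ∸ x ≡ 0
        δ≡0 = solves-unique {e = e} 0<d d<k (subst (_< p) y≡x+δ y<p) solves-x
                            (subst (λ z → Solves z d e) y≡x+δ solves-y)
      unique : ∀ x y → x < p → y < p →
               1 ≤ consecutive x * 𝟙 (solves? x d e) → 1 ≤ consecutive y * 𝟙 (solves? y d e) → x ≡ y
      unique x y x<p y<p 1≤𝟙x 1≤𝟙y =
        wlog-≤ {H = λ x y → x < p × y < p × Solves x d e × Solves y d e}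
               (λ (x<p , y<p , sx , sy) → y<p , x<p , sy , sx) sym ordered
               x y (x<p , y<p , solves-of x 1≤𝟙x , solves-of y 1≤𝟙y)

    ∑-solutions≤ : ∑[ d < k ] ∑[ e < k ] solutions d e ≤ W + (k ∸ 1) * (k ∸ 1)
    ∑-solutions≤ =
      subst (λ n → ∑[ d < n ] ∑[ e < n ] solutions d e ≤ W + (k ∸ 1) * (k ∸ 1)) 1+[k∸1]≡k
      (∑-grid (k ∸ 1) solutions W solutions00≤W
        (λ e e<k-1 → solutions0e≡0 (s≤s z≤n) (<-pred-k e<k-1))
        (λ d d<k-1 → solutionsd0≡0 (s≤s z≤n) (<-pred-k d<k-1))
        (λ d e d<k-1 _ → solutions≤1 (suc e) (s≤s z≤n) (<-pred-k d<k-1)))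
      where
      1+[k∸1]≡k : suc (k ∸ 1) ≡ k
      1+[k∸1]≡k = m+[n∸m]≡n 0<k
      <-pred-k : ∀ {d} → d < k ∸ 1 → suc d < k
      <-pred-k d<k-1 = subst (suc _ <_) 1+[k∸1]≡k (s≤s d<k-1)

    upper-bound : p ≤ m ^ 4 + 5
    upper-bound = subst (_≤ m ^ 4 + 5) km+1≡p (km+1≤m⁴+5 m k 0<m 0<k
      (subst (λ w → w * w ≤ (m * m ∸ 1) * (w + (k ∸ 1) * (k ∸ 1))) W≡km∸1
        (≤-trans W²≤ (*-monoʳ-≤ (m * m ∸ 1) (≤-trans ∑-pairCount²≤∑-solutions ∑-solutions≤)))))
      where
      W≡km∸1 : W ≡ k * m ∸ 1
      W≡km∸1 = trans W≡N∸1 (cong (_∸ 1) N≡k*m)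
      km+1≡p : k * m + 1 ≡ p
      km+1≡p = trans (cong (_+ 1) (sym N≡k*m)) (trans (+-comm N 1) 1+N≡p)

theorem4 : (m p g : ℕ) → .{{_ : NonZero m}} → .{{_ : NonZero p}} →
    6 < m → Prime p → 2 * m ∣ p ∸ 1 →
    IsPrimitiveRoot p g →
    (∀ i → i < m → ∀ x → x < p →
    InCoset p m g i x ⇔ InCoset p m g i ((p ∸ x) % p)) →
    (∀ i → i < m → ∀ x → x < p →
    InSumset p m g i i x ⇔ (¬ InCoset p m g i x)) →
    (∀ i j → i < m → j < m → i ≢ j → ∀ x → x < p →
    InSumset p m g i j x ⇔ (x ≢ 0)) →
    (2 * m * m ∸ 2 * m + 1 ≤ p) × (p ≤ m ^ 4 + 5)
theorem4 m p g _ p-prime 2m∣p-1 g-primitive negation-closed self-sum cross-sum =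
  lower-bound , upper-bound
  where
  open Cosets m p g p-prime g-primitive (m*n∣⇒n∣ 2 m 2m∣p-1)
  open LowerBound (negation-closed⇒class-[-1]≡0 negation-closed)
                  (cross-sum⇒class-shift negation-closed cross-sum)
  open UpperBound (self-sum⇒class-suc≢0 self-sum)
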